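{- Let $a,\delta$ be positive integers with $a<\delta<2a$ and $\gcd(a,\delta)=1$, put $b=a+\delta$ and $d=\delta-a$. For $n\ge 0$ let $w_n = n + a\lfloor n/a\rfloor + b\lfloor n/\delta\rfloor$. Let $n\ge\delta$ and write $n=qa+r$ with $0\le r<a$. Then $w_n-2b = w_{n-\delta}$ if $r\ge d$, and $w_n-2b=w_{n-\delta}+a$ if $r<d$. -}

module Defs where

open import Data.Nat using (ℕ; _+_; _*_; NonZero)
open import Data.Nat.DivMod using (_/_)

w : (a b δ : ℕ) → .{{NonZero a}} → .{{NonZero δ}} → ℕ → ℕ
w a b δ n = n + a * (n / a) + b * (n / δ)

module Submission where

-- Adding δ to m raises ⌊m/δ⌋ by exactly one, so w (m + δ) − w m = δ + b + a j,
-- where j is the number of multiples of a passed. Since δ = a + d with d < a,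
-- stepping back from n = q a + r by δ lowers ⌊n/a⌋ by one when r ≥ d and by two
-- (a borrow) when r < d.

open import Defs
open import Data.Nat using (ℕ; _+_; _*_; _∸_; _<_; _≤_; _≥_; NonZero)
open import Data.Nat.GCD using (gcd)
open import Data.Nat.DivMod
open import Data.Nat.Divisibility using (divides-refl; ∣-refl)
open import Data.Nat.Properties
open import Data.Nat.Tactic.RingSolver using (solve-∀)
open import Data.Product using (_×_; _,_)
open import Relation.Binary.PropositionalEquality
open ≡-Reasoning

[m*n+o]/n≡m : ∀ m n {o} .{{_ : NonZero n}} → o < n → (m * n + o) / n ≡ m
[m*n+o]/n≡m m n {o} o<n = begin
  (m * n + o) / n    ≡⟨ +-distrib-/-∣ˡ o (divides-refl m) ⟩
  m * n / n + o / n  ≡⟨ cong₂ _+_ (m*n/n≡m m n) (m<n⇒m/n≡0 o<n) ⟩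
  m + 0              ≡⟨ +-identityʳ m ⟩
  m                  ∎

[m+o*n]/n≡m/n+o : ∀ m n o .{{_ : NonZero n}} → (m + o * n) / n ≡ m / n + o
[m+o*n]/n≡m/n+o m n o =
  trans (+-distrib-/-∣ʳ m (divides-refl o)) (cong (m / n +_) (m*n/n≡m o n))

[m+n]/n≡m/n+1 : ∀ m n .{{_ : NonZero n}} → (m + n) / n ≡ m / n + 1
[m+n]/n≡m/n+1 m n = trans (+-distrib-/-∣ʳ m ∣-refl) (cong (m / n +_) (n/n≡1 n))

quotient-after-shift : ∀ {m q e} j {a} .{{_ : NonZero a}} →
                       e < a → m + j * a ≡ q * a + e → q ≡ m / a + j
quotient-after-shift {m} {q} {e} j {a} e<a eq = begin
  q                  ≡⟨ [m*n+o]/n≡m q a e<a ⟨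
  (q * a + e) / a    ≡⟨ /-congˡ eq ⟨
  (m + j * a) / a    ≡⟨ [m+o*n]/n≡m/n+o m a j ⟩
  m / a + j          ∎

w-+δ : ∀ a b δ .{{_ : NonZero a}} .{{_ : NonZero δ}} m j →
       (m + δ) / a ≡ m / a + j → w a b δ (m + δ) ≡ w a b δ m + (δ + a * j + b)
w-+δ a b δ m j quot = begin
  m + δ + a * ((m + δ) / a) + b * ((m + δ) / δ)
    ≡⟨ cong₂ (λ x y → m + δ + a * x + b * y) quot ([m+n]/n≡m/n+1 m δ) ⟩
  m + δ + a * (m / a + j) + b * (m / δ + 1)
    ≡⟨ regroup m δ a b (m / a) (m / δ) j ⟩
  m + a * (m / a) + b * (m / δ) + (δ + a * j + b)
    ∎
  where
  regroup : ∀ m δ a b x y j →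
            m + δ + a * (x + j) + b * (y + 1) ≡ m + a * x + b * y + (δ + a * j + b)
  regroup = solve-∀

w-shift-back : ∀ a b δ .{{_ : NonZero a}} .{{_ : NonZero δ}} {n q r} j →
               δ ≤ n → n ≡ q * a + r → r < a → q ≡ (n ∸ δ) / a + j →
               w a b δ n ≡ w a b δ (n ∸ δ) + (δ + a * j + b)
w-shift-back a b δ {n} {q} {r} j δ≤n n≡qa+r r<a q≡m/a+j = begin
  w a b δ n                    ≡⟨ cong (w a b δ) m+δ≡n ⟨
  w a b δ (m + δ)              ≡⟨ w-+δ a b δ m j [m+δ]/a≡m/a+j ⟩
  w a b δ m + (δ + a * j + b)  ∎
  where
  m = n ∸ δ
  m+δ≡n : m + δ ≡ n
  m+δ≡n = m∸n+n≡m δ≤n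
  [m+δ]/a≡m/a+j : (m + δ) / a ≡ m / a + j
  [m+δ]/a≡m/a+j = trans (/-congˡ (trans m+δ≡n n≡qa+r)) (trans ([m*n+o]/n≡m q a r<a) q≡m/a+j)

shift-back-without-borrow : ∀ {m q r a} d → d ≤ r →
                            m + (a + d) ≡ q * a + r → m + 1 * a ≡ q * a + (r ∸ d)
shift-back-without-borrow {m} {q} {r} {a} d d≤r eq = +-cancelʳ-≡ d _ _ (begin
  m + 1 * a + d          ≡⟨ rearrange m a d ⟩
  m + (a + d)            ≡⟨ eq ⟩
  q * a + r              ≡⟨ cong (q * a +_) (m∸n+n≡m d≤r) ⟨
  q * a + (r ∸ d + d)    ≡⟨ +-assoc (q * a) (r ∸ d) d ⟨
  q * a + (r ∸ d) + d    ∎)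
  where
  rearrange : ∀ m a d → m + 1 * a + d ≡ m + (a + d)
  rearrange = solve-∀

shift-back-with-borrow : ∀ {m q r a} d → d ≤ a →
                         m + (a + d) ≡ q * a + r → m + 2 * a ≡ q * a + (a + r ∸ d)
shift-back-with-borrow {m} {q} {r} {a} d d≤a eq = +-cancelʳ-≡ d _ _ (begin
  m + 2 * a + d            ≡⟨ rearrange m a d ⟩
  m + (a + d) + a          ≡⟨ cong (_+ a) eq ⟩
  q * a + r + a            ≡⟨ rearrange′ (q * a) r a ⟩
  q * a + (a + r)          ≡⟨ cong (q * a +_) (m∸n+n≡m (≤-trans d≤a (m≤m+n a r))) ⟨
  q * a + (a + r ∸ d + d)  ≡⟨ +-assoc (q * a) (a + r ∸ d) d ⟨
  q * a + (a + r ∸ d) + d  ∎)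
  where
  rearrange : ∀ m a d → m + 2 * a + d ≡ m + (a + d) + a
  rearrange = solve-∀
  rearrange′ : ∀ x r a → x + r + a ≡ x + (a + r)
  rearrange′ = solve-∀

lemma3p1 : (a δ : ℕ) → .{{_ : NonZero a}} → .{{_ : NonZero δ}} →
    a < δ → δ < 2 * a → gcd a δ ≡ 1 →
    (n q r : ℕ) → n ≥ δ → n ≡ q * a + r → r < a →
    ((δ ∸ a) ≤ r → w a (a + δ) δ n ≡ w a (a + δ) δ (n ∸ δ) + 2 * (a + δ))
    × (r < δ ∸ a → w a (a + δ) δ n ≡ w a (a + δ) δ (n ∸ δ) + a + 2 * (a + δ))
lemma3p1 a δ a<δ δ<2a _ n q r n≥δ n≡qa+r r<a = no-borrow , borrow
  where
  b = a + δ
  m = n ∸ δ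
  d = δ ∸ a

  a+d≡δ : a + d ≡ δ
  a+d≡δ = m+[n∸m]≡n (<⇒≤ a<δ)

  d<a : d < a
  d<a = +-cancelˡ-< a d a (subst₂ _<_ (sym a+d≡δ) (cong (a +_) (+-identityʳ a)) δ<2a)

  m+a+d≡qa+r : m + (a + d) ≡ q * a + r
  m+a+d≡qa+r = trans (cong (m +_) a+d≡δ) (trans (m∸n+n≡m n≥δ) n≡qa+r)

  no-borrow : d ≤ r → w a b δ n ≡ w a b δ m + 2 * b
  no-borrow d≤r = trans (w-shift-back a b δ 1 n≥δ n≡qa+r r<a q≡m/a+1) (regroup (w a b δ m) δ a)
    where
    q≡m/a+1 : q ≡ m / a + 1
    q≡m/a+1 = quotient-after-shift 1 (≤-<-trans (m∸n≤m r d) r<a)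
                (shift-back-without-borrow {m} {q} d d≤r m+a+d≡qa+r)
    regroup : ∀ W δ a → W + (δ + a * 1 + (a + δ)) ≡ W + 2 * (a + δ)
    regroup = solve-∀

  borrow : r < d → w a b δ n ≡ w a b δ m + a + 2 * b
  borrow r<d = trans (w-shift-back a b δ 2 n≥δ n≡qa+r r<a q≡m/a+2) (regroup (w a b δ m) δ a)
    where
    a+r∸d<a : a + r ∸ d < a
    a+r∸d<a = subst (a + r ∸ d <_) (m+n∸n≡m a d)
                (∸-monoˡ-< (+-monoʳ-< a r<d) (≤-trans (<⇒≤ d<a) (m≤m+n a r)))
    q≡m/a+2 : q ≡ m / a + 2
    q≡m/a+2 = quotient-after-shift 2 a+r∸d<a
                (shift-back-with-borrow {m} {q} d (<⇒≤ d<a) m+a+d≡qa+r)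
    regroup : ∀ W δ a → W + (δ + a * 2 + (a + δ)) ≡ W + a + 2 * (a + δ)
    regroup = solve-∀
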